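{- There exist a finite group $G$ and a connected symmetric $G$-vertex-transitive graph $\Gamma$ of order $40$ and valency $12$ such that $\Gamma$ is not a Cayley graph of $G$ and $\Gamma$ is not a GI-graph of $G$.
   Context: All graphs are finite digraphs without loops or multiple arcs; a graph is undirected if its arc relation is symmetric. A graph $\Gamma$ is $G$-vertex-transitive if $G$ is a subgroup of $\mathrm{Aut}(\Gamma)$ acting transitively on the vertices; $\Gamma$ is symmetric if $\mathrm{Aut}(\Gamma)$ acts transitively on the arcs of $\Gamma$. For a finite group $G$, a core-free subgroup $H$ of $G$ (one containing no nontrivial normal subgroup of $G$) and a subset $S\subseteq G\setminus H$, the coset graph $\mathrm{Cos}(G,H,HSH)$ has vertex set the set $[G{:}H]$ of right cosets of $H$ in $G$, with an arc $Hx\to Hy$ iff $yx^{ -1}\in HSH$. Every $G$-vertex-transitive graph $\Gamma$ is isomorphic (compatibly with the $G$-actions, $G$ acting on cosets by right multiplication) to $\mathrm{Cos}(G,G_\alpha,G_\alpha S G_\alpha)$ where $\alpha$ is a vertex and $S$ is the set of elements of $G$ mapping $\alpha$ to its out-neighbours. A Cayley graph of $G$ is a coset graph $\mathrm{Cos}(G,1,S)$. The graph $\Gamma=\mathrm{Cos}(G,H,HSH)$ is a GI-graph of $G$ if for every $T\subseteq G\setminus H$ with $\mathrm{Cos}(G,H,HTH)\cong\Gamma$ there exists $\tau\in\mathrm{Aut}(G)$ with $H^\tau=H$ and $HS^\tau H=HTH$. -}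

module Defs where

open import Level using (0ℓ)
open import Data.Nat using (ℕ)
open import Data.Bool using (Bool; true; false; T)
open import Data.Fin using (Fin)
open import Data.Fin.Subset using (∣_∣)
open import Data.Fin.Permutation using (Permutation′; _⟨$⟩ʳ_)
open import Data.Vec using (tabulate)
open import Data.Product using (Σ; ∃; ∃-syntax; _×_; _,_)
open import Function.Bundles using (_⇔_)
open import Function.Definitions using (Surjective)
open import Relation.Binary.PropositionalEquality using (_≡_)
open import Relation.Binary.Construct.Closure.ReflexiveTransitive using (Star)
open import Relation.Unary using (Pred; _⊆_; ∁)
open import Algebra.Structures using (IsGroup)

record FinGroup : Set where
  infixl 7 _∙_
  field
    order   : ℕ
    _∙_     : Fin order → Fin order → Fin order
    ε       : Fin order
    _⁻¹     : Fin order → Fin order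
    isGroup : IsGroup _≡_ _∙_ ε _⁻¹

  Carrier : Set
  Carrier = Fin order

  Subset : Set₁
  Subset = Pred Carrier 0ℓ

  trivial : Subset
  trivial g = g ≡ ε

  triple : Subset → Subset → Subset → Subset
  triple A S B g = ∃[ a ] ∃[ s ] ∃[ b ] (A a × S s × B b × g ≡ a ∙ s ∙ b)

  record Automorphism : Set where
    field
      fun     : Carrier → Carrier
      inv     : Carrier → Carrier
      invˡ    : ∀ x → inv (fun x) ≡ x
      invʳ    : ∀ x → fun (inv x) ≡ x
      hom     : ∀ x y → fun (x ∙ y) ≡ fun x ∙ fun y

  image : Automorphism → Subset → Subset
  image τ S g = ∃[ s ] (S s × Automorphism.fun τ s ≡ g)

record Digraph (m : ℕ) : Set where
  field
    Adj      : Fin m → Fin m → Bool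
    loopless : ∀ v → Adj v v ≡ false

module _ {m : ℕ} (Γ : Digraph m) where
  open Digraph Γ

  Arc : Fin m → Fin m → Set
  Arc u v = T (Adj u v)

  HasValency : ℕ → Set
  HasValency k = ∀ v → ∣ tabulate (Adj v) ∣ ≡ k

  Connected : Set
  Connected = ∀ u v → Star Arc u v

  IsGraphAut : Permutation′ m → Set
  IsGraphAut π = ∀ u v → Adj (π ⟨$⟩ʳ u) (π ⟨$⟩ʳ v) ≡ Adj u v

  IsSymmetric : Set
  IsSymmetric = ∀ u v u′ v′ → Arc u v → Arc u′ v′ →
    Σ (Permutation′ m) λ π → IsGraphAut π × π ⟨$⟩ʳ u ≡ u′ × π ⟨$⟩ʳ v ≡ v′

-- G-vertex-transitive: G is (via a faithful right action) a subgroup of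
-- Aut(Γ) acting transitively on the vertices.

record VertexTransitiveAction (G : FinGroup) {m : ℕ} (Γ : Digraph m) : Set where
  open FinGroup G
  open Digraph Γ
  field
    act        : Carrier → Fin m → Fin m
    act-ε      : ∀ v → act ε v ≡ v
    act-∙      : ∀ g h v → act (g ∙ h) v ≡ act h (act g v)
    act-adj    : ∀ g u v → Adj (act g u) (act g v) ≡ Adj u v
    faithful   : ∀ g → (∀ v → act g v ≡ v) → g ≡ ε
    transitive : ∀ u v → ∃[ g ] act g u ≡ v

-- Cos(G,H,D) has vertex set the right cosets [G:H] and an arc
-- Hx → Hy iff y x⁻¹ ∈ D.  Since Agda has no quotient types, an isomorphism
-- Cos(G,H,D) ≅ Γ is given as a surjection f : G → V(Γ) whose fibres are
-- exactly the right cosets of H (f x ≡ f y ⇔ Hx = Hy ⇔ x y⁻¹ ∈ H) and which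
-- maps the arc relation of the coset graph onto that of Γ.

module _ (G : FinGroup) where
  open FinGroup G

  CosIso : (H D : Subset) {m : ℕ} → Digraph m → Set
  CosIso H D {m} Γ = Σ (Carrier → Fin m) λ f →
      Surjective _≡_ _≡_ f
    × (∀ x y → (f x ≡ f y) ⇔ H (x ∙ y ⁻¹))
    × (∀ x y → Arc Γ (f x) (f y) ⇔ D (y ∙ x ⁻¹))

  -- Γ is a Cayley graph of G: Γ ≅ Cos(G,1,S) for some S ⊆ G \ {1}
  IsCayleyGraphOf : {m : ℕ} → Digraph m → Set₁
  IsCayleyGraphOf Γ = Σ Subset λ S →
    S ⊆ ∁ trivial × CosIso trivial (triple trivial S trivial) Γ

  IsGI : (H S : Subset) {m : ℕ} → Digraph m → Set₁
  IsGI H S Γ = ∀ (T : Subset) → T ⊆ ∁ H → CosIso H (triple H T H) Γ →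
    Σ Automorphism λ τ →
        (∀ g → H (Automorphism.fun τ g) ⇔ H g)
      × (∀ g → triple H (image τ S) H g ⇔ triple H T H g)

-- Γ, viewed as Cos(G, G_α, G_α S G_α) with S = { g | α^g is an out-neighbour of α },
-- is a GI-graph of G.
IsGIGraphAt : (G : FinGroup) {m : ℕ} (Γ : Digraph m) →
  VertexTransitiveAction G Γ → Fin m → Set₁
IsGIGraphAt G Γ A α =
  IsGI G (λ g → act g α ≡ α) (λ g → Arc Γ α (act g α)) Γ
  where open VertexTransitiveAction A

-- G = (Z/2)² × AGL(1,5), of order 80, acts on the 40 vertices of Γ = K₄ × K₂ × K₅ (tensor
-- product, valency 3 · 1 · 4 = 12): the affine factor y ↦ 2ʲ y + k acts on Z/5 = V(K₅), and
-- V(K₄) × V(K₂) = (Z/2)³ is translated by (u, j mod 2, e), where (u, e) ∈ (Z/2)². As |G| ≠ 40,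
-- Γ is not a Cayley graph of G. A Z/2-linear bijection L of (Z/2)³ keeps K₄ × K₂ translation
-- invariant, so pulling Γ back along L × id gives a G-invariant graph isomorphic to Γ, that is a
-- second connection set T with Cos(G, G_α, G_α T G_α) ≅ Γ. Involutions of G have j even, and L
-- sends their translations into the plane c = 0, which no edge of K₄ × K₂ stays in; so T contains
-- no involution, while the connection set S of Γ does. Automorphisms of G preserve involutions,
-- hence none carries G_α S G_α onto G_α T G_α.

module Submission where

open import Defs
open import Algebra.Bundles using (Group; RawGroup)
open import Algebra.Morphism.Structures using (module GroupMorphisms)
import Algebra.Morphism.GroupMonomorphism as GroupMonomorphism
import Algebra.Properties.Group as GroupProperties
open import Algebra.Structures using (IsGroup)
open import Data.Bool using (Bool; false; T; not; _∧_)
import Data.Bool.Properties as Bool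
open import Data.Fin using (Fin; toℕ; #_; combine; remQuot; _↑ˡ_; _≟_) renaming (zero to 0F)
open import Data.Fin.Permutation using (Permutation′; _⟨$⟩ʳ_; _⟨$⟩ˡ_; transpose; _∘ₚ_)
import Data.Fin.Permutation as Perm
import Data.Fin.Permutation.Components as PC
open import Data.Fin.Properties using (all?; any?; pigeonhole; <⇒≢; remQuot-combine; combine-remQuot)
open import Data.Fin.Subset using (∣_∣)
open import Data.Nat using (ℕ; zero; suc; NonZero; _+_; _*_; _∸_; _^_; _<_; s≤s; z≤n)
import Data.Nat as ℕ
open import Data.Nat.DivMod using (_mod_)
open import Data.Nat.Properties using (m<m+n)
open import Data.Product using (Σ; ∃; _×_; _,_; proj₂; uncurry)
open import Data.Product.Function.NonDependent.Propositional using (_×-↔_)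
open import Data.Product.Properties using (≡-dec)
open import Data.Sum using (_⊎_; inj₁; inj₂)
open import Data.Vec using (tabulate)
open import Function.Base using (_∘_)
open import Function.Bundles using (Equivalence; Injection; Inverse; _↔_; mk⇔; mk↔ₛ′)
open import Function.Definitions using (Injective)
open import Function.Properties.Inverse using (↔-refl; ↔-sym; ↔-trans; ↔⇒↣)
open import Level using (0ℓ)
open import Relation.Binary.Construct.Closure.ReflexiveTransitive using (Star; _◅_; gmap) renaming (ε to [])
open import Relation.Binary.Definitions using (DecidableEquality)
open import Relation.Binary.PropositionalEquality
  using (_≡_; _≢_; refl; sym; trans; cong; cong₂; subst; subst₂; isEquivalence; module ≡-Reasoning)
open import Relation.Nullary using (Dec; ¬_; does; yes; no)
open import Relation.Nullary.Decidable using (True; toWitness; T?; map′; dec-true; dec-false; _×-dec_; _⊎-dec_; _→-dec_)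
open import Relation.Unary using (Pred; Decidable; _⊆_; ∁)

module FinGroupProperties (G : FinGroup) where
  open FinGroup G

  asGroup : Group _ _
  asGroup = record { isGroup = isGroup }

  open Group asGroup public using (assoc; identityˡ; identityʳ; inverseˡ; inverseʳ)
  open GroupProperties asGroup public

  module _ (τ : Automorphism) where
    open Automorphism τ

    automorphism-ε : fun ε ≡ ε
    automorphism-ε = identityʳ-unique (fun ε) (fun ε) (trans (sym (hom ε ε)) (cong fun (identityˡ ε)))

    automorphism-involution : ∀ {s} → s ∙ s ≡ ε → fun s ∙ fun s ≡ ε
    automorphism-involution {s} s²≡ε = trans (sym (hom s s)) (trans (cong fun s²≡ε) automorphism-ε)

module _ (G : FinGroup) {m : ℕ} (Γ : Digraph m) where
  open FinGroup G
  open FinGroupProperties G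

  <order⇒¬cosIso-trivial : ∀ {D} → m < order → ¬ CosIso G trivial D Γ
  <order⇒¬cosIso-trivial m<order (f , _ , fibres , _) with pigeonhole m<order f
  ... | x , y , x<y , fx≡fy = <⇒≢ x<y (x∙y⁻¹≈ε⇒x≈y x y (Equivalence.to (fibres x y) fx≡fy))

  <order⇒¬cayley : m < order → ¬ IsCayleyGraphOf G Γ
  <order⇒¬cayley m<order (S , _ , iso) = <order⇒¬cosIso-trivial {triple trivial S trivial} m<order iso

-- Vertex-transitive actions and twisted connection sets

module VertexTransitiveActionProperties {G : FinGroup} {m : ℕ} {Γ : Digraph m}
  (A : VertexTransitiveAction G Γ) where
  open FinGroup G
  open FinGroupProperties G
  open VertexTransitiveAction A
  open Digraph Γ

  act-inverseˡ : ∀ g v → act (g ⁻¹) (act g v) ≡ v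
  act-inverseˡ g v = begin
    act (g ⁻¹) (act g v) ≡⟨ act-∙ g (g ⁻¹) v ⟨
    act (g ∙ g ⁻¹) v     ≡⟨ cong (λ h → act h v) (inverseʳ g) ⟩
    act ε v              ≡⟨ act-ε v ⟩
    v                    ∎
    where open ≡-Reasoning

  act-inverseʳ : ∀ g v → act g (act (g ⁻¹) v) ≡ v
  act-inverseʳ g v = begin
    act g (act (g ⁻¹) v) ≡⟨ act-∙ (g ⁻¹) g v ⟨
    act (g ⁻¹ ∙ g) v     ≡⟨ cong (λ h → act h v) (inverseˡ g) ⟩
    act ε v              ≡⟨ act-ε v ⟩
    v                    ∎
    where open ≡-Reasoning

  act-arc : ∀ g {u v} → Arc Γ u v → Arc Γ (act g u) (act g v)
  act-arc g {u} {v} = subst T (sym (act-adj g u v))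

  reachable⇒connected : ∀ v₀ → (∀ v → Star (Arc Γ) v₀ v) → Connected Γ
  reachable⇒connected v₀ reach u v with transitive v₀ u
  ... | g , v₀g≡u = subst₂ (Star (Arc Γ)) v₀g≡u (act-inverseʳ g v)
    (gmap (act g) (act-arc g) (reach (act (g ⁻¹) v)))

  ε-sandwich : ∀ g → g ≡ ε ∙ g ∙ ε
  ε-sandwich g = sym (trans (identityʳ (ε ∙ g)) (identityˡ g))

  -- The pull-back of Γ along φ is G-invariant, and Twisted is its connection set at α.
  module TwistedConnectionSet (φ : Permutation′ m)
    (φ-invariant : ∀ g u v → Adj (φ ⟨$⟩ʳ act g u) (φ ⟨$⟩ʳ act g v) ≡ Adj (φ ⟨$⟩ʳ u) (φ ⟨$⟩ʳ v))
    (α : Fin m) where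

    Stab : Subset
    Stab g = act g α ≡ α

    twistedAdj : Carrier → Bool
    twistedAdj g = Adj (φ ⟨$⟩ʳ α) (φ ⟨$⟩ʳ act g α)

    Twisted : Subset
    Twisted g = T (twistedAdj g)

    twistedAdj-translate : ∀ g x → Adj (φ ⟨$⟩ʳ act x α) (φ ⟨$⟩ʳ act (g ∙ x) α) ≡ twistedAdj g
    twistedAdj-translate g x = trans (cong (λ w → Adj (φ ⟨$⟩ʳ act x α) (φ ⟨$⟩ʳ w)) (act-∙ g x α))
                                     (φ-invariant x α (act g α))

    stab-absorbˡ : ∀ {a} g → Stab a → act (a ∙ g) α ≡ act g α
    stab-absorbˡ {a} g a∈Stab = trans (act-∙ a g α) (cong (act g) a∈Stab)

    triple-twisted⊆twisted : triple Stab Twisted Stab ⊆ Twisted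
    triple-twisted⊆twisted {g} (a , s , b , a∈Stab , s∈T , b∈Stab , refl) = subst T (sym twistedAdj-asb) s∈T
      where
      twistedAdj-asb : twistedAdj (a ∙ s ∙ b) ≡ twistedAdj s
      twistedAdj-asb = begin
        Adj (φ ⟨$⟩ʳ α) (φ ⟨$⟩ʳ act (a ∙ s ∙ b) α)         ≡⟨ cong (λ w → Adj (φ ⟨$⟩ʳ α) (φ ⟨$⟩ʳ act w α)) (assoc a s b) ⟩
        Adj (φ ⟨$⟩ʳ α) (φ ⟨$⟩ʳ act (a ∙ (s ∙ b)) α)       ≡⟨ cong₂ (λ v w → Adj (φ ⟨$⟩ʳ v) (φ ⟨$⟩ʳ w)) (sym b∈Stab) (stab-absorbˡ (s ∙ b) a∈Stab) ⟩
        Adj (φ ⟨$⟩ʳ act b α) (φ ⟨$⟩ʳ act (s ∙ b) α)       ≡⟨ twistedAdj-translate s b ⟩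
        twistedAdj s                                       ∎
        where open ≡-Reasoning

    twisted⊆triple : Twisted ⊆ triple Stab Twisted Stab
    twisted⊆triple {g} g∈T = ε , g , ε , act-ε α , g∈T , act-ε α , ε-sandwich g

    twisted⊆∁stab : Twisted ⊆ ∁ Stab
    twisted⊆∁stab {g} g∈T g∈Stab = subst T (trans (cong (λ w → Adj (φ ⟨$⟩ʳ α) (φ ⟨$⟩ʳ w)) g∈Stab) (loopless (φ ⟨$⟩ʳ α))) g∈T

    orbit : Carrier → Fin m
    orbit x = φ ⟨$⟩ʳ act x α

    orbit-fibres : ∀ x y → orbit x ≡ orbit y → Stab (x ∙ y ⁻¹)
    orbit-fibres x y eq = begin
      act (x ∙ y ⁻¹) α       ≡⟨ act-∙ x (y ⁻¹) α ⟩
      act (y ⁻¹) (act x α)   ≡⟨ cong (act (y ⁻¹)) (Injection.injective (↔⇒↣ φ) eq) ⟩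
      act (y ⁻¹) (act y α)   ≡⟨ act-inverseˡ y α ⟩
      α                      ∎
      where open ≡-Reasoning

    orbit-stab : ∀ x y → Stab (x ∙ y ⁻¹) → orbit x ≡ orbit y
    orbit-stab x y x/y∈Stab = cong (φ ⟨$⟩ʳ_) (begin
      act x α                  ≡⟨ cong (λ w → act w α) (//-rightDividesˡ y x) ⟨
      act (x ∙ y ⁻¹ ∙ y) α     ≡⟨ stab-absorbˡ y x/y∈Stab ⟩
      act y α                  ∎)
      where open ≡-Reasoning

    orbit-arc : ∀ x y → Adj (orbit x) (orbit y) ≡ twistedAdj (y ∙ x ⁻¹)
    orbit-arc x y = trans (cong (λ w → Adj (orbit x) (φ ⟨$⟩ʳ act w α)) (sym (//-rightDividesˡ x y)))
                          (twistedAdj-translate (y ∙ x ⁻¹) x)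

    cosIso-twisted : CosIso G Stab (triple Stab Twisted Stab) Γ
    cosIso-twisted = orbit , orbit-surjective
      , (λ x y → mk⇔ (orbit-fibres x y) (orbit-stab x y))
      , (λ x y → mk⇔ (λ arc → twisted⊆triple (subst T (orbit-arc x y) arc))
                     (λ t → subst T (sym (orbit-arc x y)) (triple-twisted⊆twisted t)))
      where
      orbit-surjective : ∀ v → ∃ λ x → ∀ {z} → z ≡ x → orbit z ≡ v
      orbit-surjective v with transitive α (φ ⟨$⟩ˡ v)
      ... | x , αx≡φ⁻¹v = x , λ { refl → trans (cong (φ ⟨$⟩ʳ_) αx≡φ⁻¹v) (Perm.inverseʳ φ) }

    involution-free-twist⇒¬GI : ∀ s → Arc Γ α (act s α) → s ∙ s ≡ ε →
      (∀ g → g ∙ g ≡ ε → ¬ Twisted g) → ¬ IsGIGraphAt G Γ A α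
    involution-free-twist⇒¬GI s s∈S s²≡ε no-involution gi
      with gi Twisted twisted⊆∁stab cosIso-twisted
    ... | τ , _ , same-triple = no-involution (fun s) (automorphism-involution τ s²≡ε)
      (triple-twisted⊆twisted (Equivalence.to (same-triple (fun s))
        (ε , fun s , ε , act-ε α , (s , s∈S , refl) , act-ε α , ε-sandwich (fun s))))
      where open Automorphism τ

module _ {m : ℕ} (Γ : Digraph m) where
  open Digraph Γ

  WalkWithin : ℕ → Fin m → Fin m → Set
  WalkWithin zero    u v = u ≡ v
  WalkWithin (suc k) u v = u ≡ v ⊎ ∃ λ w → Arc Γ u w × WalkWithin k w v

  walkWithin? : ∀ k u v → Dec (WalkWithin k u v)
  walkWithin? zero    u v = u ≟ v
  walkWithin? (suc k) u v = (u ≟ v) ⊎-dec any? λ w → T? (Adj u w) ×-dec walkWithin? k w v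

  walkWithin⇒star : ∀ k {u v} → WalkWithin k u v → Star (Arc Γ) u v
  walkWithin⇒star zero    refl                = []
  walkWithin⇒star (suc k) (inj₁ refl)         = []
  walkWithin⇒star (suc k) (inj₂ (w , uw , wv)) = uw ◅ walkWithin⇒star k wv

module _ {n : ℕ} where

  transpose-matchˡ : ∀ (i j : Fin n) → PC.transpose i j i ≡ j
  transpose-matchˡ i j rewrite dec-true (i ≟ i) refl = refl

  transpose-fix : ∀ {i j k : Fin n} → k ≢ i → k ≢ j → PC.transpose i j k ≡ k
  transpose-fix {i} {j} {k} k≢i k≢j rewrite dec-false (k ≟ i) k≢i | dec-false (k ≟ j) k≢j = refl

  transpose-injective : ∀ (i j : Fin n) → Injective _≡_ _≡_ (PC.transpose i j)
  transpose-injective i j {x} {y} eq = begin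
      x                                        ≡⟨ PC.transpose-inverse j i ⟨
      PC.transpose j i (PC.transpose i j x)    ≡⟨ cong (PC.transpose j i) eq ⟩
      PC.transpose j i (PC.transpose i j y)    ≡⟨ PC.transpose-inverse j i ⟩
      y                                        ∎
    where open ≡-Reasoning

  pairPermutation : ∀ {a b a′ b′ : Fin n} → a ≢ b → a′ ≢ b′ →
    Σ (Permutation′ n) λ π → π ⟨$⟩ʳ a ≡ a′ × π ⟨$⟩ʳ b ≡ b′
  pairPermutation {a} {b} {a′} {b′} a≢b a′≢b′ =
    transpose a a′ ∘ₚ transpose c b′ , trans (cong (PC.transpose c b′) (transpose-matchˡ a a′)) (transpose-fix a′≢c a′≢b′)
                                      , transpose-matchˡ c b′
    where
    c = PC.transpose a a′ b
    a′≢c : a′ ≢ c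
    a′≢c a′≡c = a≢b (transpose-injective a a′ (trans (transpose-matchˡ a a′) a′≡c))

  _≠ᵇ_ : Fin n → Fin n → Bool
  x ≠ᵇ y = not (does (x ≟ y))

  ≠ᵇ-injective : ∀ {f : Fin n → Fin n} → Injective _≡_ _≡_ f → ∀ x y → f x ≠ᵇ f y ≡ x ≠ᵇ y
  ≠ᵇ-injective {f} f-injective x y with x ≟ y
  ... | yes refl = cong not (dec-true (f x ≟ f x) refl)
  ... | no x≢y   = cong not (dec-false (f x ≟ f y) (x≢y ∘ f-injective))

  ≠ᵇ⇒≢ : ∀ {x y : Fin n} → T (x ≠ᵇ y) → x ≢ y
  ≠ᵇ⇒≢ {x} {y} x≠y with x ≟ y
  ≠ᵇ⇒≢ () | yes _
  ... | no x≢y = x≢y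

  ≠ᵇ-permutation : ∀ (π : Permutation′ n) x y → (π ⟨$⟩ʳ x) ≠ᵇ (π ⟨$⟩ʳ y) ≡ x ≠ᵇ y
  ≠ᵇ-permutation π = ≠ᵇ-injective (Injection.injective (↔⇒↣ π))

*↔× : ∀ {m n} → Fin (m * n) ↔ (Fin m × Fin n)
*↔× {m} {n} = mk↔ₛ′ (remQuot n) (uncurry combine) (uncurry remQuot-combine) (combine-remQuot {m} n)

decide : {A : Set} (a? : Dec A) → {True a?} → A
decide a? {a} = toWitness a

all?↔ : ∀ {n} {X : Set} (code : Fin n ↔ X) {P : Pred X 0ℓ} → Decidable P → Dec (∀ x → P x)
all?↔ code {P} P? = map′ (λ ∀P x → subst P (Inverse.strictlyInverseˡ code x) (∀P (Inverse.from code x)))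
                        (λ ∀P i → ∀P (Inverse.to code i))
                        (all? (λ i → P? (Inverse.to code i)))

module Transport {X V : Set} {n m : ℕ} (codeG : Fin n ↔ X) (codeV : Fin m ↔ V)
  {_·_ : X → X → X} {e : X} {inv : X → X} (isGroupX : IsGroup _≡_ _·_ e inv)
  (adj : V → V → Bool) (adj-irreflexive : ∀ x → adj x x ≡ false)
  where
  open Inverse codeG using () renaming (to to decodeG; from to encodeG;
    strictlyInverseˡ to decodeG-encodeG; strictlyInverseʳ to encodeG-decodeG)
  open Inverse codeV using () renaming (to to decodeV; from to encodeV;
    strictlyInverseˡ to decodeV-encodeV; strictlyInverseʳ to encodeV-decodeV)

  rawGroupX : RawGroup _ _
  rawGroupX = record { _≈_ = _≡_ ; _∙_ = _·_ ; ε = e ; _⁻¹ = inv }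

  rawGroupFin : RawGroup _ _
  rawGroupFin = record
    { _≈_ = _≡_
    ; _∙_ = λ g h → encodeG (decodeG g · decodeG h)
    ; ε   = encodeG e
    ; _⁻¹ = encodeG ∘ inv ∘ decodeG
    }

  decodeG-isGroupMonomorphism : GroupMorphisms.IsGroupMonomorphism rawGroupFin rawGroupX decodeG
  decodeG-isGroupMonomorphism = record
    { isGroupHomomorphism = record
      { isMonoidHomomorphism = record
        { isMagmaHomomorphism = record
          { isRelHomomorphism = record { cong = cong decodeG }
          ; homo = λ g h → decodeG-encodeG _
          }
        ; ε-homo = decodeG-encodeG e
        }
      ; ⁻¹-homo = λ g → decodeG-encodeG _
      }
    ; injective = λ {g} {h} eq → trans (sym (encodeG-decodeG g)) (trans (cong encodeG eq) (encodeG-decodeG h))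
    }

  group : FinGroup
  group = record
    { order   = n
    ; _∙_     = RawGroup._∙_ rawGroupFin
    ; ε       = RawGroup.ε rawGroupFin
    ; _⁻¹     = RawGroup._⁻¹ rawGroupFin
    ; isGroup = GroupMonomorphism.isGroup decodeG-isGroupMonomorphism isGroupX
    }

  graph : Digraph m
  graph = record { Adj = λ u v → adj (decodeV u) (decodeV v) ; loopless = λ v → adj-irreflexive (decodeV v) }

  conjugate : V ↔ V → Permutation′ m
  conjugate ρ = ↔-trans codeV (↔-trans ρ (↔-sym codeV))

  Adj-conjugate : ∀ (ρ : V ↔ V) u v →
    Digraph.Adj graph (conjugate ρ ⟨$⟩ʳ u) (conjugate ρ ⟨$⟩ʳ v) ≡ adj (Inverse.to ρ (decodeV u)) (Inverse.to ρ (decodeV v))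
  Adj-conjugate ρ u v = cong₂ adj (decodeV-encodeV _) (decodeV-encodeV _)

  symmetric : (∀ {x y x′ y′} → T (adj x y) → T (adj x′ y′) → Σ (V ↔ V) λ ρ →
                (∀ x y → adj (Inverse.to ρ x) (Inverse.to ρ y) ≡ adj x y)
                × Inverse.to ρ x ≡ x′ × Inverse.to ρ y ≡ y′) →
              IsSymmetric graph
  symmetric arc-transitive u v u′ v′ uv u′v′ with arc-transitive uv u′v′
  ... | ρ , ρ-adj , ρu≡u′ , ρv≡v′ = conjugate ρ
      , (λ x y → trans (Adj-conjugate ρ x y) (ρ-adj (decodeV x) (decodeV y)))
      , trans (cong encodeV ρu≡u′) (encodeV-decodeV u′)
      , trans (cong encodeV ρv≡v′) (encodeV-decodeV v′)

  open FinGroup group using (_∙_; ε)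

  decodeG-involution : ∀ {g} → g ∙ g ≡ ε → decodeG g · decodeG g ≡ e
  decodeG-involution {g} g²≡ε = begin
    decodeG g · decodeG g                      ≡⟨ decodeG-encodeG _ ⟨
    decodeG (encodeG (decodeG g · decodeG g))  ≡⟨ cong decodeG g²≡ε ⟩
    decodeG (encodeG e)                        ≡⟨ decodeG-encodeG e ⟩
    e                                          ∎
    where open ≡-Reasoning

  module Action (_▹_ : V → X → V)
    (▹-identity : ∀ x → x ▹ e ≡ x)
    (▹-∙ : ∀ x g h → x ▹ (g · h) ≡ (x ▹ g) ▹ h)
    where

    ▹-transitive-from-transversal : ∀ x₀ (t : V → X) → (∀ x → x₀ ▹ t x ≡ x) →
      ∀ x y → ∃ λ g → x ▹ g ≡ y
    ▹-transitive-from-transversal x₀ t x₀▹t x y = inv (t x) · t y , (begin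
      x ▹ (inv (t x) · t y)             ≡⟨ ▹-∙ x (inv (t x)) (t y) ⟩
      (x ▹ inv (t x)) ▹ t y             ≡⟨ cong (λ z → (z ▹ inv (t x)) ▹ t y) (x₀▹t x) ⟨
      ((x₀ ▹ t x) ▹ inv (t x)) ▹ t y    ≡⟨ cong (_▹ t y) (▹-∙ x₀ (t x) (inv (t x))) ⟨
      (x₀ ▹ (t x · inv (t x))) ▹ t y    ≡⟨ cong (λ g → (x₀ ▹ g) ▹ t y) (IsGroup.inverseʳ isGroupX (t x)) ⟩
      (x₀ ▹ e) ▹ t y                    ≡⟨ cong (_▹ t y) (▹-identity x₀) ⟩
      x₀ ▹ t y                          ≡⟨ x₀▹t y ⟩
      y                                 ∎)
      where open ≡-Reasoning

    act : Fin n → Fin m → Fin m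
    act g v = encodeV (decodeV v ▹ decodeG g)

    decodeV-act : ∀ g v → decodeV (act g v) ≡ decodeV v ▹ decodeG g
    decodeV-act g v = decodeV-encodeV _

    act-fixes⇒▹-fixes : ∀ g → (∀ v → act g v ≡ v) → ∀ x → x ▹ decodeG g ≡ x
    act-fixes⇒▹-fixes g fixes x = begin
      x ▹ decodeG g                     ≡⟨ cong (_▹ decodeG g) (decodeV-encodeV x) ⟨
      decodeV (encodeV x) ▹ decodeG g   ≡⟨ decodeV-act g (encodeV x) ⟨
      decodeV (act g (encodeV x))       ≡⟨ cong decodeV (fixes (encodeV x)) ⟩
      decodeV (encodeV x)               ≡⟨ decodeV-encodeV x ⟩
      x                                 ∎
      where open ≡-Reasoning

    act-∙ : ∀ g h v → act (g ∙ h) v ≡ act h (act g v)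
    act-∙ g h v = begin
      encodeV (decodeV v ▹ decodeG (encodeG (decodeG g · decodeG h)))  ≡⟨ cong (λ k → encodeV (decodeV v ▹ k)) (decodeG-encodeG _) ⟩
      encodeV (decodeV v ▹ (decodeG g · decodeG h))                    ≡⟨ cong encodeV (▹-∙ (decodeV v) (decodeG g) (decodeG h)) ⟩
      encodeV ((decodeV v ▹ decodeG g) ▹ decodeG h)                    ≡⟨ cong (λ x → encodeV (x ▹ decodeG h)) (decodeV-act g v) ⟨
      act h (act g v)                                                  ∎
      where open ≡-Reasoning

    action : (∀ g x y → adj (x ▹ g) (y ▹ g) ≡ adj x y) →
             (∀ g → (∀ x → x ▹ g ≡ x) → g ≡ e) →
             (∀ x y → ∃ λ g → x ▹ g ≡ y) →
             VertexTransitiveAction group graph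
    action ▹-adj ▹-faithful ▹-transitive = record
      { act        = act
      ; act-ε      = λ v → trans (cong (λ g → encodeV (decodeV v ▹ g)) (decodeG-encodeG e))
                                 (trans (cong encodeV (▹-identity (decodeV v))) (encodeV-decodeV v))
      ; act-∙      = act-∙
      ; act-adj    = λ g u v → trans (cong₂ adj (decodeV-act g u) (decodeV-act g v)) (▹-adj (decodeG g) (decodeV u) (decodeV v))
      ; faithful   = λ g fixes → trans (sym (encodeG-decodeG g))
                                       (cong encodeG (▹-faithful (decodeG g) (act-fixes⇒▹-fixes g fixes)))
      ; transitive = λ u v → let (g , u▹g≡v) = ▹-transitive (decodeV u) (decodeV v) in
          encodeG g , trans (cong (λ k → encodeV (decodeV u ▹ k)) (decodeG-encodeG g))
                            (trans (cong encodeV u▹g≡v) (encodeV-decodeV v))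
      }

    involution-arc : (∀ x → ∃ λ g → g · g ≡ e × T (adj x (x ▹ g))) →
      ∀ v → ∃ λ s → Arc graph v (act s v) × s ∙ s ≡ ε
    involution-arc involution v with involution (decodeV v)
    ... | g , g²≡e , arc = encodeG g
      , subst (λ y → T (adj (decodeV v) y)) (sym (trans (decodeV-act (encodeG g) v) (cong (decodeV v ▹_) (decodeG-encodeG g)))) arc
      , cong encodeG (trans (cong₂ _·_ (decodeG-encodeG g) (decodeG-encodeG g)) g²≡e)

    module _ (ρ : V ↔ V) where
      open Inverse ρ using () renaming (to to twist)

      conjugate-invariant : (∀ g x y → adj (twist (x ▹ g)) (twist (y ▹ g)) ≡ adj (twist x) (twist y)) →
        ∀ g u v → Digraph.Adj graph (conjugate ρ ⟨$⟩ʳ act g u) (conjugate ρ ⟨$⟩ʳ act g v)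
                ≡ Digraph.Adj graph (conjugate ρ ⟨$⟩ʳ u) (conjugate ρ ⟨$⟩ʳ v)
      conjugate-invariant invariant g u v = begin
        Digraph.Adj graph (conjugate ρ ⟨$⟩ʳ act g u) (conjugate ρ ⟨$⟩ʳ act g v)
          ≡⟨ Adj-conjugate ρ (act g u) (act g v) ⟩
        adj (twist (decodeV (act g u))) (twist (decodeV (act g v)))
          ≡⟨ cong₂ (λ x y → adj (twist x) (twist y)) (decodeV-act g u) (decodeV-act g v) ⟩
        adj (twist (decodeV u ▹ decodeG g)) (twist (decodeV v ▹ decodeG g))
          ≡⟨ invariant (decodeG g) (decodeV u) (decodeV v) ⟩
        adj (twist (decodeV u)) (twist (decodeV v))
          ≡⟨ Adj-conjugate ρ u v ⟨
        Digraph.Adj graph (conjugate ρ ⟨$⟩ʳ u) (conjugate ρ ⟨$⟩ʳ v)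
          ∎
        where open ≡-Reasoning

      conjugate-involution-free : (∀ g x → g · g ≡ e → adj (twist x) (twist (x ▹ g)) ≡ false) →
        ∀ v g → g ∙ g ≡ ε → ¬ Arc graph (conjugate ρ ⟨$⟩ʳ v) (conjugate ρ ⟨$⟩ʳ act g v)
      conjugate-involution-free involution-free v g g²≡ε = subst T (begin
        Digraph.Adj graph (conjugate ρ ⟨$⟩ʳ v) (conjugate ρ ⟨$⟩ʳ act g v)
          ≡⟨ Adj-conjugate ρ v (act g v) ⟩
        adj (twist (decodeV v)) (twist (decodeV (act g v)))
          ≡⟨ cong (λ y → adj (twist (decodeV v)) (twist y)) (decodeV-act g v) ⟩
        adj (twist (decodeV v)) (twist (decodeV v ▹ decodeG g))
          ≡⟨ involution-free (decodeG g) (decodeV v) (decodeG-involution g²≡ε) ⟩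
        false ∎)
        where open ≡-Reasoning

-- The example

_+ₘ_ : ∀ {n} .{{_ : NonZero n}} → Fin n → Fin n → Fin n
_+ₘ_ {n} i j = (toℕ i + toℕ j) mod n

-ₘ_ : ∀ {n} .{{_ : NonZero n}} → Fin n → Fin n
-ₘ_ {n} i = (n ∸ toℕ i) mod n

_⊕_ : Fin 4 → Fin 4 → Fin 4
a ⊕ b with remQuot {2} 2 a | remQuot {2} 2 b
... | a₁ , a₀ | b₁ , b₀ = combine (a₁ +ₘ b₁) (a₀ +ₘ b₀)

parity : Fin 4 → Fin 2
parity j = toℕ j mod 2

scale : Fin 4 → Fin 5 → Fin 5
scale j b = (2 ^ toℕ j * toℕ b) mod 5

P : Set
P = Fin 4 × Fin 2

V : Set
V = P × Fin 5

Elt : Set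
Elt = Fin 2 × Fin 2 × Fin 4 × Fin 5

codeV : Fin 40 ↔ V
codeV = ↔-trans *↔× (*↔× ×-↔ ↔-refl)

codeP : Fin 8 ↔ P
codeP = *↔×

codeG : Fin 80 ↔ Elt
codeG = ↔-trans *↔× (↔-refl ×-↔ ↔-trans *↔× (↔-refl ×-↔ *↔×))

infix 4 _≟ᴱ_ _≟ⱽ_ _≟ᴾ_
_≟ᴱ_ : DecidableEquality Elt
_≟ᴱ_ = ≡-dec _≟_ (≡-dec _≟_ (≡-dec _≟_ _≟_))

_≟ᴾ_ : DecidableEquality P
_≟ᴾ_ = ≡-dec _≟_ _≟_

_≟ⱽ_ : DecidableEquality V
_≟ⱽ_ = ≡-dec (≡-dec _≟_ _≟_) _≟_

-- (u , e , j , k) is (u , e) ∈ (Z/2)² together with the affine map y ↦ 2ʲ y + k of Z/5;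
-- products compose left to right because G acts on the right.
infixl 7 _·_
_·_ : Elt → Elt → Elt
(u , e , j , k) · (u′ , e′ , j′ , k′) = u +ₘ u′ , e +ₘ e′ , j +ₘ j′ , scale j′ k +ₘ k′

𝟙 : Elt
𝟙 = 0F , 0F , 0F , 0F

_⁻¹ᴱ : Elt → Elt
(u , e , j , k) ⁻¹ᴱ = u , e , -ₘ j , -ₘ scale (-ₘ j) k

+₂-assoc : ∀ (a b c : Fin 2) → (a +ₘ b) +ₘ c ≡ a +ₘ (b +ₘ c)
+₂-assoc = decide (all? λ a → all? λ b → all? λ c → _ ≟ _)

+₄-assoc : ∀ (a b c : Fin 4) → (a +ₘ b) +ₘ c ≡ a +ₘ (b +ₘ c)
+₄-assoc = decide (all? λ a → all? λ b → all? λ c → _ ≟ _)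

scale-affine : ∀ j j′ k k′ b → scale j′ (scale j b +ₘ k) +ₘ k′ ≡ scale (j +ₘ j′) b +ₘ (scale j′ k +ₘ k′)
scale-affine = decide (all? λ j → all? λ j′ → all? λ k → all? λ k′ → all? λ b → _ ≟ _)

·-assoc : ∀ x y z → (x · y) · z ≡ x · (y · z)
·-assoc (u , e , j , k) (u′ , e′ , j′ , k′) (u″ , e″ , j″ , k″) =
  cong₂ _,_ (+₂-assoc u u′ u″) (cong₂ _,_ (+₂-assoc e e′ e″) (cong₂ _,_ (+₄-assoc j j′ j″) (scale-affine j′ j″ k′ k″ k)))

·-identityˡ : ∀ x → 𝟙 · x ≡ x
·-identityˡ = decide (all?↔ codeG λ x → (𝟙 · x) ≟ᴱ x)

·-identityʳ : ∀ x → x · 𝟙 ≡ x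
·-identityʳ = decide (all?↔ codeG λ x → (x · 𝟙) ≟ᴱ x)

·-inverseˡ : ∀ x → (x ⁻¹ᴱ) · x ≡ 𝟙
·-inverseˡ = decide (all?↔ codeG λ x → ((x ⁻¹ᴱ) · x) ≟ᴱ 𝟙)

·-inverseʳ : ∀ x → x · (x ⁻¹ᴱ) ≡ 𝟙
·-inverseʳ = decide (all?↔ codeG λ x → (x · (x ⁻¹ᴱ)) ≟ᴱ 𝟙)

isGroupElt : IsGroup _≡_ _·_ 𝟙 _⁻¹ᴱ
isGroupElt = record
  { isMonoid = record
    { isSemigroup = record
      { isMagma = record { isEquivalence = isEquivalence ; ∙-cong = cong₂ _·_ }
      ; assoc   = ·-assoc
      }
    ; identity = ·-identityˡ , ·-identityʳ
    }
  ; inverse = ·-inverseˡ , ·-inverseʳ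
  ; ⁻¹-cong = cong _⁻¹ᴱ
  }

infixl 6 _⊞_
_⊞_ : P → P → P
(A , c) ⊞ (B , d) = A ⊕ B , c +ₘ d

shift : Elt → P
shift (u , e , j , k) = combine u (parity j) , e

affine : Elt → Fin 5 → Fin 5
affine (u , e , j , k) b = scale j b +ₘ k

infixl 5 _▹_
_▹_ : V → Elt → V
(p , b) ▹ g = p ⊞ shift g , affine g b

adjP : P → P → Bool
adjP (A , c) (A′ , c′) = A ≠ᵇ A′ ∧ c ≠ᵇ c′

adj : V → V → Bool
adj (p , b) (p′ , b′) = adjP p p′ ∧ b ≠ᵇ b′

adj-irreflexive : ∀ x → adj x x ≡ false
adj-irreflexive = decide (all?↔ codeV λ x → adj x x Bool.≟ false)

origin : V
origin = (0F , 0F) , 0F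

⊞-assoc : ∀ p q r → (p ⊞ q) ⊞ r ≡ p ⊞ (q ⊞ r)
⊞-assoc = decide (all?↔ codeP λ p → all?↔ codeP λ q → all?↔ codeP λ r → ((p ⊞ q) ⊞ r) ≟ᴾ (p ⊞ (q ⊞ r)))

shift-· : ∀ g h → shift (g · h) ≡ shift g ⊞ shift h
shift-· = decide (all?↔ codeG λ g → all?↔ codeG λ h → shift (g · h) ≟ᴾ (shift g ⊞ shift h))

affine-· : ∀ g h b → affine (g · h) b ≡ affine h (affine g b)
affine-· (u , e , j , k) (u′ , e′ , j′ , k′) b = sym (scale-affine j j′ k k′ b)

▹-identity : ∀ x → x ▹ 𝟙 ≡ x
▹-identity = decide (all?↔ codeV λ x → (x ▹ 𝟙) ≟ⱽ x)

▹-· : ∀ x g h → x ▹ (g · h) ≡ (x ▹ g) ▹ h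
▹-· (p , b) g h = cong₂ _,_ (trans (cong (p ⊞_) (shift-· g h)) (sym (⊞-assoc p (shift g) (shift h)))) (affine-· g h b)

adjP-translation-invariant : ∀ t p p′ → adjP (p ⊞ t) (p′ ⊞ t) ≡ adjP p p′
adjP-translation-invariant = decide (all?↔ codeP λ t → all?↔ codeP λ p → all?↔ codeP λ p′ → adjP (p ⊞ t) (p′ ⊞ t) Bool.≟ adjP p p′)

affine-≠ᵇ : ∀ g b b′ → affine g b ≠ᵇ affine g b′ ≡ b ≠ᵇ b′
affine-≠ᵇ = decide (all?↔ codeG λ g → all? λ b → all? λ b′ → (affine g b ≠ᵇ affine g b′) Bool.≟ (b ≠ᵇ b′))

▹-adj : ∀ g x y → adj (x ▹ g) (y ▹ g) ≡ adj x y
▹-adj g (p , b) (p′ , b′) = cong₂ _∧_ (adjP-translation-invariant (shift g) p p′) (affine-≠ᵇ g b b′)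

fixes-two-points⇒𝟙 : ∀ g → origin ▹ g ≡ origin → ((0F , 0F) , # 1) ▹ g ≡ ((0F , 0F) , # 1) → g ≡ 𝟙
fixes-two-points⇒𝟙 = decide (all?↔ codeG λ g → (_ ≟ⱽ _) →-dec ((_ ≟ⱽ _) →-dec (g ≟ᴱ 𝟙)))

▹-faithful : ∀ g → (∀ x → x ▹ g ≡ x) → g ≡ 𝟙
▹-faithful g fixes = fixes-two-points⇒𝟙 g (fixes _) (fixes _)

transversal : V → Elt
transversal ((A , c) , b) with remQuot {2} 2 A
... | u , a₀ = u , c , a₀ ↑ˡ 2 , b

transversal-▹ : ∀ x → origin ▹ transversal x ≡ x
transversal-▹ = decide (all?↔ codeV λ x → (origin ▹ transversal x) ≟ⱽ x)

twistP : P → P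
twistP (A , c) with remQuot {2} 2 A
... | a₁ , a₀ = combine (a₀ +ₘ c) (a₁ +ₘ c) , a₀

untwistP : P → P
untwistP (B , y) with remQuot {2} 2 B
... | x₁ , x₀ = combine (x₀ +ₘ (x₁ +ₘ y)) y , x₁ +ₘ y

twist↔ : V ↔ V
twist↔ = mk↔ₛ′ twistP untwistP
  (decide (all?↔ codeP λ p → twistP (untwistP p) ≟ᴾ p))
  (decide (all?↔ codeP λ p → untwistP (twistP p) ≟ᴾ p))
  ×-↔ ↔-refl

twistP-⊞ : ∀ p q → twistP (p ⊞ q) ≡ twistP p ⊞ twistP q
twistP-⊞ = decide (all?↔ codeP λ p → all?↔ codeP λ q → twistP (p ⊞ q) ≟ᴾ (twistP p ⊞ twistP q))

twist-invariant : ∀ g x y → adj (Inverse.to twist↔ (x ▹ g)) (Inverse.to twist↔ (y ▹ g)) ≡ adj (Inverse.to twist↔ x) (Inverse.to twist↔ y)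
twist-invariant g (p , b) (p′ , b′) = cong₂ _∧_ adjP-twisted (affine-≠ᵇ g b b′)
  where
  adjP-twisted : adjP (twistP (p ⊞ shift g)) (twistP (p′ ⊞ shift g)) ≡ adjP (twistP p) (twistP p′)
  adjP-twisted = trans (cong₂ adjP (twistP-⊞ p (shift g)) (twistP-⊞ p′ (shift g)))
                       (adjP-translation-invariant (twistP (shift g)) (twistP p) (twistP p′))

-- An involution has j even, so its shift lies in Fin 4 × Fin 2 with low bit 0, which twistP
-- sends to the plane c = 0.
twistP-shift-involution : ∀ g → g · g ≡ 𝟙 → proj₂ (twistP (shift g)) ≡ 0F
twistP-shift-involution = decide (all?↔ codeG λ g → (g · g ≟ᴱ 𝟙) →-dec (proj₂ (twistP (shift g)) ≟ 0F))

adjP-⊞-even : ∀ q t → proj₂ t ≡ 0F → adjP q (q ⊞ t) ≡ false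
adjP-⊞-even = decide (all?↔ codeP λ q → all?↔ codeP λ t → (proj₂ t ≟ 0F) →-dec (adjP q (q ⊞ t) Bool.≟ false))

twist-involution-free : ∀ g x → g · g ≡ 𝟙 → adj (Inverse.to twist↔ x) (Inverse.to twist↔ (x ▹ g)) ≡ false
twist-involution-free g (p , b) g²≡𝟙 = cong (_∧ (b ≠ᵇ affine g b))
  (trans (cong (adjP (twistP p)) (twistP-⊞ p (shift g)))
         (adjP-⊞-even (twistP p) (twistP (shift g)) (twistP-shift-involution g g²≡𝟙)))

-- On Z/5 this is y ↦ 2b + 1 − y (as 2² = −1), which moves b to b + 1.
reflectionAt : V → Elt
reflectionAt (p , b) = # 1 , # 1 , # 2 , (2 * toℕ b + 1) mod 5

reflectionAt-involution-arc : ∀ x → reflectionAt x · reflectionAt x ≡ 𝟙 × T (adj x (x ▹ reflectionAt x))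
reflectionAt-involution-arc = decide (all?↔ codeV λ x → (_ ≟ᴱ _) ×-dec T? (adj x (x ▹ reflectionAt x)))

adj⇒distinct : ∀ {A A′ c c′ b b′} → T (adj ((A , c) , b) ((A′ , c′) , b′)) → (A ≢ A′ × c ≢ c′) × b ≢ b′
adj⇒distinct arc with Equivalence.to Bool.T-∧ arc
... | Ac , b≠b′ with Equivalence.to Bool.T-∧ Ac
...   | A≠A′ , c≠c′ = (≠ᵇ⇒≢ A≠A′ , ≠ᵇ⇒≢ c≠c′) , ≠ᵇ⇒≢ b≠b′

adj-arc-transitive : ∀ {x y x′ y′} → T (adj x y) → T (adj x′ y′) → Σ (V ↔ V) λ ρ →
  (∀ x y → adj (Inverse.to ρ x) (Inverse.to ρ y) ≡ adj x y) × Inverse.to ρ x ≡ x′ × Inverse.to ρ y ≡ y′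
adj-arc-transitive xy x′y′ with adj⇒distinct xy | adj⇒distinct x′y′
... | (A≢ , c≢) , b≢ | (A′≢ , c′≢) , b′≢
    with pairPermutation A≢ A′≢ | pairPermutation c≢ c′≢ | pairPermutation b≢ b′≢
... | πA , πA-x , πA-y | πc , πc-x , πc-y | πb , πb-x , πb-y =
  ((πA ×-↔ πc) ×-↔ πb)
  , (λ { ((A , c) , b) ((A′ , c′) , b′) → cong₂ _∧_ (cong₂ _∧_ (≠ᵇ-permutation πA A A′) (≠ᵇ-permutation πc c c′)) (≠ᵇ-permutation πb b b′) })
  , cong₂ _,_ (cong₂ _,_ πA-x πc-x) πb-x
  , cong₂ _,_ (cong₂ _,_ πA-y πc-y) πb-y

open Transport codeG codeV isGroupElt adj adj-irreflexive
open Action _▹_ ▹-identity ▹-·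

vertexTransitive : VertexTransitiveAction group graph
vertexTransitive = action ▹-adj ▹-faithful (▹-transitive-from-transversal origin transversal transversal-▹)

open VertexTransitiveActionProperties vertexTransitive

graph-connected : Connected graph
graph-connected = reachable⇒connected 0F λ v → walkWithin⇒star graph 3 (walkWithin3 v)
  where
  walkWithin3 : ∀ v → WalkWithin graph 3 0F v
  walkWithin3 = decide (all? λ v → walkWithin? graph 3 0F v)

graph-valency : HasValency graph 12
graph-valency = decide (all? λ v → ∣ tabulate (Digraph.Adj graph v) ∣ ℕ.≟ 12)

graph-¬GI : ∀ α → ¬ IsGIGraphAt group graph vertexTransitive α
graph-¬GI α =
  let s , arc , s²≡ε = involution-arc (λ x → reflectionAt x , reflectionAt-involution-arc x) α
  in involution-free-twist⇒¬GI s arc s²≡ε (conjugate-involution-free twist↔ twist-involution-free α)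
  where open TwistedConnectionSet (conjugate twist↔) (conjugate-invariant twist↔ twist-invariant) α

mainTheorem1 : Σ FinGroup λ G → Σ (Digraph 40) λ Γ → Σ (VertexTransitiveAction G Γ) λ A →
    Connected Γ × IsSymmetric Γ × HasValency Γ 12 ×
    ¬ IsCayleyGraphOf G Γ × (∀ (α : Fin 40) → ¬ IsGIGraphAt G Γ A α)
mainTheorem1 = group , graph , vertexTransitive
  , graph-connected
  , symmetric adj-arc-transitive
  , graph-valency
  , <order⇒¬cayley group graph (m<m+n 40 (s≤s z≤n))
  , graph-¬GI
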